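{- Let $p$ be a prime number. Then the set of all solutions $(x,y,z)$ in non-negative integers of the Diophantine equation $$p^x + p^y = z^2$$ is exactly the following: - if $p = 2$: the triples $(2s+3,\, 2s,\, 3\cdot 2^s)$, $(2s,\, 2s+3,\, 3\cdot 2^s)$ and $(2s+1,\, 2s+1,\, 2^{s+1})$, where $s$ ranges over all non-negative integers; - if $p = 3$: the triples $(2s+1,\, 2s,\, 2\cdot 3^s)$ and $(2s,\, 2s+1,\, 2\cdot 3^s)$, where $s$ ranges over all non-negative integers; - if $p > 3$: there are no solutions. -}

module Defs where

open import Data.Nat using (ℕ; _+_; _*_; _^_)

data Sol : ℕ → ℕ → ℕ → ℕ → Set where
  two-a   : ∀ s → Sol 2 (2 * s + 3) (2 * s) (3 * 2 ^ s)
  two-b   : ∀ s → Sol 2 (2 * s) (2 * s + 3) (3 * 2 ^ s)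
  two-c   : ∀ s → Sol 2 (2 * s + 1) (2 * s + 1) (2 ^ (s + 1))
  three-a : ∀ s → Sol 3 (2 * s + 1) (2 * s) (2 * 3 ^ s)
  three-b : ∀ s → Sol 3 (2 * s) (2 * s + 1) (2 * 3 ^ s)

module Submission where

open import Defs
open import Data.Nat using (ℕ; _+_; _^_)
open import Data.Nat.Primality using (Prime)
open import Relation.Binary.PropositionalEquality using (_≡_)
open import Function.Bundles using (_⇔_)

open import Data.Nat using (zero; suc; _*_; _<_; NonZero)
open import Data.Nat.Base using (nonTrivial⇒n>1)
open import Data.Nat.Properties
  using (+-comm; *-comm; +-identityʳ; *-identityʳ; *-distribˡ-+; ^-distribˡ-+-*;
         *-cancelˡ-≡; suc-injective; <-irrefl; m*n≡1⇒m≡1; m*n≡1⇒n≡1;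
         m^n≡1⇒n≡0∨m≡1; m^n>0)
open import Data.Nat.Divisibility
  using (_∣_; divides; divides-refl; _∣?_; ∣1⇒≡1; ∣m+n∣m⇒∣n; m∣m*n)
open import Data.Nat.Coprimality using (Coprime; coprime-divisor)
open import Data.Nat.Primality
  using (prime?; prime[2]; euclidsLemma; prime⇒irreducible; prime⇒nonZero; prime⇒nonTrivial)
open import Data.Nat.Tactic.RingSolver using (solve-∀)
open import Data.Product using (∃-syntax; _×_; _,_)
open import Data.Sum using (_⊎_; inj₁; inj₂)
open import Data.Empty using (⊥-elim)
open import Relation.Nullary using (¬_; yes; no)
open import Relation.Nullary.Decidable using (from-yes)
open import Relation.Binary.PropositionalEquality
  using (refl; sym; trans; cong; cong₂; subst; module ≡-Reasoning)
open import Function.Bundles using (mk⇔)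

-- Soundness: each listed family is checked by writing p^(2s+k) = (p^s)² · p^k,
-- which reduces the equation to one of the identities 8+1 = 3², 2+2 = 2², 3+1 = 2².
--
-- Completeness is a descent on x and y.  If x, y ≥ 2 then p² divides z², hence
-- p divides z, and dividing by p² gives a smaller solution; the solution set Sol is
-- closed under the inverse step (x, y, z) ↦ (x+2, y+2, p·z).  The boundary cases are:
--   * x = 0:  p^y = (z-1)(z+1).  Both factors divide p^y, so each is 1 or a multiple
--     of p.  Either z - 1 = 1 (giving 1 + 3 = 2²), or p divides both, so p = 2 and
--     writing z - 1 = 2u leaves 2^(y-2) = u(u+1), a product of consecutive integers,
--     forcing u = 1 (giving 1 + 2³ = 3²);
--   * x = 1:  p(1 + p^y) = z² gives 1 + p^y = p·q², so y = 0, p = 2, q = 1.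
-- The cases y = 0 and y = 1 follow by the symmetry x ↔ y.

-- Writing squares as products, so that the ring solver applies.
square : ∀ z → z ^ 2 ≡ z * z
square z = cong (z *_) (*-identityʳ z)

*-swapˡ : ∀ m n o → m * (n * o) ≡ n * (m * o)
*-swapˡ = solve-∀

Sol-cong : ∀ {p x y z x′ y′ z′} → x ≡ x′ → y ≡ y′ → z ≡ z′ → Sol p x y z → Sol p x′ y′ z′
Sol-cong refl refl refl s = s

Sol-swap : ∀ {p x y z} → Sol p x y z → Sol p y x z
Sol-swap (two-a s)   = two-b s
Sol-swap (two-b s)   = two-a s
Sol-swap (two-c s)   = two-c s
Sol-swap (three-a s) = three-b s
Sol-swap (three-b s) = three-a s

double-suc : ∀ s → 2 * suc s ≡ 2 + 2 * s
double-suc = solve-∀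

double-suc-plus : ∀ s k → 2 * suc s + k ≡ 2 + (2 * s + k)
double-suc-plus s k = cong (_+ k) (double-suc s)

Sol-shift : ∀ {p x y z} → Sol p x y z → Sol p (2 + x) (2 + y) (p * z)
Sol-shift (two-a s) =
  Sol-cong (double-suc-plus s 3) (double-suc s) (*-swapˡ 3 2 (2 ^ s)) (two-a (suc s))
Sol-shift (two-b s) =
  Sol-cong (double-suc s) (double-suc-plus s 3) (*-swapˡ 3 2 (2 ^ s)) (two-b (suc s))
Sol-shift (two-c s) =
  Sol-cong (double-suc-plus s 1) (double-suc-plus s 1) refl (two-c (suc s))
Sol-shift (three-a s) =
  Sol-cong (double-suc-plus s 1) (double-suc s) (*-swapˡ 2 3 (3 ^ s)) (three-a (suc s))
Sol-shift (three-b s) =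
  Sol-cong (double-suc s) (double-suc-plus s 1) (*-swapˡ 2 3 (3 ^ s)) (three-b (suc s))

even-power : ∀ p s → p ^ (2 * s) ≡ p ^ s * p ^ s
even-power p s = trans (^-distribˡ-+-* p s (s + 0)) (cong (λ t → p ^ s * p ^ t) (+-identityʳ s))

even-power-times : ∀ p s k → p ^ (2 * s + k) ≡ p ^ s * p ^ s * p ^ k
even-power-times p s k =
  trans (^-distribˡ-+-* p (2 * s) k) (cong (_* p ^ k) (even-power p s))

Sol⇒solution : ∀ {p x y z} → Sol p x y z → p ^ x + p ^ y ≡ z * z
Sol⇒solution (two-a s) = begin
    2 ^ (2 * s + 3) + 2 ^ (2 * s)  ≡⟨ cong₂ _+_ (even-power-times 2 s 3) (even-power 2 s) ⟩
    a * a * 8 + a * a              ≡⟨ eight-plus-one a ⟩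
    3 * a * (3 * a)                ∎
  where
  open ≡-Reasoning
  a : ℕ
  a = 2 ^ s
  eight-plus-one : ∀ a → a * a * 8 + a * a ≡ 3 * a * (3 * a)
  eight-plus-one = solve-∀
Sol⇒solution (two-b s) = trans (+-comm (2 ^ (2 * s)) _) (Sol⇒solution (two-a s))
Sol⇒solution (two-c s) = begin
    2 ^ (2 * s + 1) + 2 ^ (2 * s + 1)  ≡⟨ cong₂ _+_ (even-power-times 2 s 1) (even-power-times 2 s 1) ⟩
    a * a * 2 + a * a * 2              ≡⟨ two-plus-two a ⟩
    a * 2 * (a * 2)                    ≡⟨ cong (λ t → t * t) (sym (^-distribˡ-+-* 2 s 1)) ⟩
    2 ^ (s + 1) * 2 ^ (s + 1)          ∎
  where
  open ≡-Reasoning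
  a : ℕ
  a = 2 ^ s
  two-plus-two : ∀ a → a * a * 2 + a * a * 2 ≡ a * 2 * (a * 2)
  two-plus-two = solve-∀
Sol⇒solution (three-a s) = begin
    3 ^ (2 * s + 1) + 3 ^ (2 * s)  ≡⟨ cong₂ _+_ (even-power-times 3 s 1) (even-power 3 s) ⟩
    a * a * 3 + a * a              ≡⟨ three-plus-one a ⟩
    2 * a * (2 * a)                ∎
  where
  open ≡-Reasoning
  a : ℕ
  a = 3 ^ s
  three-plus-one : ∀ a → a * a * 3 + a * a ≡ 2 * a * (2 * a)
  three-plus-one = solve-∀
Sol⇒solution (three-b s) = trans (+-comm (3 ^ (2 * s)) _) (Sol⇒solution (three-a s))

prime[3] : Prime 3
prime[3] = from-yes (prime? 3)

module _ {p : ℕ} (pp : Prime p) where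

  private instance
    p≢0 : NonZero p
    p≢0 = prime⇒nonZero pp

  1<p : 1 < p
  1<p = nonTrivial⇒n>1 p {{prime⇒nonTrivial pp}}

  p∤1 : ¬ p ∣ 1
  p∤1 p∣1 = <-irrefl (sym (∣1⇒≡1 p∣1)) 1<p

  prime-divisor-of-prime : ∀ {q} → Prime q → p ∣ q → p ≡ q
  prime-divisor-of-prime pq p∣q with prime⇒irreducible pq p∣q
  ... | inj₁ p≡1 = ⊥-elim (<-irrefl (sym p≡1) 1<p)
  ... | inj₂ p≡q = p≡q

  coprime-to-p : ∀ {a} → ¬ p ∣ a → Coprime a p
  coprime-to-p p∤a (d∣a , d∣p) with prime⇒irreducible pp d∣p
  ... | inj₁ d≡1 = d≡1
  ... | inj₂ refl = ⊥-elim (p∤a d∣a)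

  divisor-of-power : ∀ {a} k → a ∣ p ^ k → a ≡ 1 ⊎ p ∣ a
  divisor-of-power {a} k a∣pᵏ with p ∣? a
  ... | yes p∣a = inj₂ p∣a
  ... | no  p∤a = inj₁ (coprime-divisor-of-power k a∣pᵏ)
    where
    coprime-divisor-of-power : ∀ k → a ∣ p ^ k → a ≡ 1
    coprime-divisor-of-power zero    a∣1    = ∣1⇒≡1 a∣1
    coprime-divisor-of-power (suc k) a∣pᵏ⁺¹ =
      coprime-divisor-of-power k (coprime-divisor (coprime-to-p p∤a) a∣pᵏ⁺¹)

  p∣square⇒p∣ : ∀ {z} → p ∣ z * z → p ∣ z
  p∣square⇒p∣ {z} p∣z² with euclidsLemma z z pp p∣z²
  ... | inj₁ p∣z = p∣z
  ... | inj₂ p∣z = p∣z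

  square-multiple : ∀ {n z} → p * n ≡ z * z → ∃[ q ] z ≡ p * q × n ≡ p * (q * q)
  square-multiple {n} {z} e with p∣square⇒p∣ {z} (subst (p ∣_) e (m∣m*n n))
  ... | divides-refl q = q , *-comm q p , *-cancelˡ-≡ n (p * (q * q)) p (trans e (regroup p q))
    where
    regroup : ∀ p q → q * p * (q * p) ≡ p * (p * (q * q))
    regroup = solve-∀

  power≡1 : ∀ t → p ^ t ≡ 1 → t ≡ 0
  power≡1 t pᵗ≡1 with m^n≡1⇒n≡0∨m≡1 p t pᵗ≡1
  ... | inj₁ t≡0 = t≡0
  ... | inj₂ p≡1 = ⊥-elim (<-irrefl (sym p≡1) 1<p)

  power≡p : ∀ t → p ^ t ≡ p → t ≡ 1
  power≡p zero    1≡p   = ⊥-elim (<-irrefl 1≡p 1<p)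
  power≡p (suc t) pᵗ⁺¹≡p =
    cong suc (power≡1 t (*-cancelˡ-≡ (p ^ t) 1 p (trans pᵗ⁺¹≡p (sym (*-identityʳ p)))))

  -- A power of p that is a product u(u+1) of consecutive numbers has u = 1:
  -- the coprime factors cannot both be multiples of p, and u + 1 = 1 would make p^m = 0.
  consecutive-product : ∀ m u → p ^ m ≡ u * suc u → u ≡ 1
  consecutive-product m u e
    with divisor-of-power {u} m (divides (suc u) (trans e (*-comm u (suc u))))
       | divisor-of-power {suc u} m (divides u e)
  ... | inj₁ u≡1 | _         = u≡1
  ... | inj₂ _   | inj₁ refl = ⊥-elim (<-irrefl (sym e) (m^n>0 p m))
  ... | inj₂ p∣u | inj₂ p∣u+1 = ⊥-elim (p∤1 (∣m+n∣m⇒∣n (subst (p ∣_) (+-comm 1 u) p∣u+1) p∣u))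

-- p = 2 and z = 2u + 1, so 2^(k+1) = 4u(u+1), i.e. 2^k = 2u(u+1): only u = 1, k = 2,
-- which is the solution 1 + 2³ = 3².
two-power-as-2u[u+1] : ∀ k u → 2 ^ k ≡ 2 * (u * suc u) → Sol 2 0 (suc k) (suc (u * 2))
two-power-as-2u[u+1] zero    u e = ⊥-elim (p∤1 prime[2] (divides (u * suc u) (trans e (*-comm 2 (u * suc u)))))
two-power-as-2u[u+1] (suc k) u e with consecutive-product prime[2] k u (*-cancelˡ-≡ _ _ 2 e)
... | refl with power≡p prime[2] k (*-cancelˡ-≡ _ _ 2 e)
... | refl = two-b 0

-- x = 0 with z = w + 1: p^y = w(w + 2).
power-as-w[w+2] : ∀ {p} → Prime p → ∀ y w → p ^ y ≡ w * (2 + w) → Sol p 0 y (suc w)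
power-as-w[w+2] pp zero w e with m*n≡1⇒n≡1 w (2 + w) (sym e)
... | ()
power-as-w[w+2] {p} pp (suc k) w e
  with divisor-of-power pp {w} (suc k) (divides (2 + w) (trans e (*-comm w (2 + w))))
     | divisor-of-power pp {2 + w} (suc k) (divides w e)
... | _         | inj₁ ()
... | inj₁ refl | inj₂ _ = three-plus-one
  where
  -- w = 1 gives p^(k+1) = 3, so p = 3 and k = 0.
  three-plus-one : Sol p 0 (suc k) 2
  three-plus-one with prime-divisor-of-prime pp prime[3] (divides (p ^ k) (trans (sym e) (*-comm p _)))
  ... | refl with power≡p pp (suc k) e
  ... | refl = three-b 0
... | inj₂ p∣w  | inj₂ p∣2+w
  with prime-divisor-of-prime pp prime[2] (∣m+n∣m⇒∣n (subst (p ∣_) (+-comm 2 w) p∣2+w) p∣w)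
... | refl = even-case w p∣w e
  where
  -- p = 2 divides w = 2u, and 2^(k+1) = 2u(2u + 2) = 2 · 2(u(u+1)).
  even-case : ∀ w → 2 ∣ w → 2 ^ suc k ≡ w * (2 + w) → Sol 2 0 (suc k) (suc w)
  even-case .(u * 2) (divides-refl u) e =
    two-power-as-2u[u+1] k u (*-cancelˡ-≡ (2 ^ k) _ 2 (trans e (regroup u)))
    where
    regroup : ∀ u → u * 2 * (2 + u * 2) ≡ 2 * (2 * (u * suc u))
    regroup = solve-∀

zero-exponent : ∀ {p} → Prime p → ∀ y z → p ^ 0 + p ^ y ≡ z * z → Sol p 0 y z
zero-exponent pp y (suc w) e = power-as-w[w+2] pp y w (suc-injective (trans e (expand w)))
  where
  expand : ∀ w → suc w * suc w ≡ 1 + w * (2 + w)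
  expand = solve-∀

-- x = 1:  p(1 + p^y) = z² forces 1 + p^y = p·q², hence y = 0, p = 2 and z = 2.
one-exponent : ∀ {p} → Prime p → ∀ y z → p ^ 1 + p ^ suc y ≡ z * z → Sol p 1 (suc y) z
one-exponent {p} pp y z e with square-multiple pp {z = z} (trans (*-distribˡ-+ p 1 (p ^ y)) e)
... | q , refl , e′ = from-quotient y e′
  where
  from-quotient : ∀ y → 1 + p ^ y ≡ p * (q * q) → Sol p 1 (suc y) (p * q)
  from-quotient (suc y) e′ =
    ⊥-elim (p∤1 pp (∣m+n∣m⇒∣n (subst (p ∣_) (trans (sym e′) (+-comm 1 _)) (m∣m*n (q * q))) (m∣m*n (p ^ y))))
  from-quotient zero e′ with prime-divisor-of-prime pp prime[2] (divides (q * q) (trans e′ (*-comm p _)))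
  ... | refl with m*n≡1⇒m≡1 q q (sym (*-cancelˡ-≡ 1 (q * q) 2 e′))
  ... | refl = two-c 0

*-distribˡ-+² : ∀ p a b → p * (p * (a + b)) ≡ p * (p * a) + p * (p * b)
*-distribˡ-+² = solve-∀

-- Descent: for x, y ≥ 2 divide the solution by p² and apply Sol-shift.
solution⇒Sol : ∀ {p} → Prime p → ∀ x y z → p ^ x + p ^ y ≡ z * z → Sol p x y z
solution⇒Sol     pp zero          y       z e = zero-exponent pp y z e
solution⇒Sol     pp (suc x)       zero    z e =
  Sol-swap (zero-exponent pp (suc x) z (trans (+-comm 1 _) e))
solution⇒Sol     pp 1             (suc y) z e = one-exponent pp y z e
solution⇒Sol {p} pp (suc (suc x)) 1       z e =
  Sol-swap (one-exponent pp (suc x) z (trans (+-comm (p ^ 1) _) e))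
solution⇒Sol {p} pp (suc (suc x)) (suc (suc y)) z e
  with square-multiple pp {z = z} (trans (*-distribˡ-+² p (p ^ x) (p ^ y)) e)
... | q , refl , e′ = Sol-shift (solution⇒Sol pp x y q (*-cancelˡ-≡ _ _ p {{prime⇒nonZero pp}} e′))

theorem3p2 : (p : ℕ) → Prime p → (x y z : ℕ) →
    (p ^ x + p ^ y ≡ z ^ 2) ⇔ Sol p x y z
theorem3p2 p pp x y z = mk⇔
  (λ e → solution⇒Sol pp x y z (trans e (square z)))
  (λ s → trans (Sol⇒solution s) (sym (square z)))
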